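{- For every integer $n\ge2$ and every $x$, $$\sum_{k=1}^n S(n,k)\frac{x^k}{k^2} = \frac1n\sum_{k=1}^n\binom{n}{k}B^+_{n-k}\left\{\frac1k\sum_{m=1}^k\binom{k}{m}B^+_{k-m}\varphi_m(x)\right\},$$ and in particular $$\sum_{k=1}^n S(n,k)\frac{1}{k^2} = \frac1n\sum_{k=1}^n\binom{n}{k}B^+_{n-k}\left\{\frac1k\sum_{m=1}^k\binom{k}{m}B^+_{k-m}b_m\right\}.$$
   Context: $S(n,k)$ are the Stirling numbers of the second kind, $\varphi_n(x)=\sum_{k=0}^n S(n,k)x^k$ are the exponential polynomials, and $b_n=\varphi_n(1)$ are the Bell numbers. $B_n$ are the Bernoulli numbers defined by $\frac{t}{e^t-1}=\sum_{n\ge0}B_n\frac{t^n}{n!}$, and $B^+_n$ is defined by $B^+_n = B_n$ for $n\ne1$ and $B^+_1 = \tfrac12$.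
   Formalization: The variable x ranges over the rationals. -}

module Defs where

open import Data.Nat as ℕ using (ℕ; zero; suc)
open import Data.Nat.Combinatorics using (_C_)
open import Data.Integer using (+_)
open import Data.Rational using (ℚ; 0ℚ; 1ℚ; ½; _+_; _*_; -_; _/_)
open import Data.Fin using (Fin; toℕ)
open import Data.Vec using (Vec; []; _∷_; _∷ʳ_; lookup; last)

ℕ→ℚ : ℕ → ℚ
ℕ→ℚ n = + n / 1

-- 1/k for k ≥ 1 (only ever used with k ≥ 1; value at 0 is an irrelevant convention)
inv : ℕ → ℚ
inv zero    = 0ℚ
inv (suc k) = + 1 / suc k

pow : ℚ → ℕ → ℚ
pow x zero    = 1ℚ
pow x (suc k) = pow x k * x

sum0 : ℕ → (ℕ → ℚ) → ℚ
sum0 zero    f = f 0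
sum0 (suc n) f = sum0 n f + f (suc n)

sum1 : ℕ → (ℕ → ℚ) → ℚ
sum1 zero    f = 0ℚ
sum1 (suc n) f = sum1 n f + f (suc n)

S : ℕ → ℕ → ℕ
S zero    zero    = 1
S zero    (suc k) = 0
S (suc n) zero    = 0
S (suc n) (suc k) = suc k ℕ.* S n (suc k) ℕ.+ S n k

φ : ℕ → ℚ → ℚ
φ n x = sum0 n (λ k → ℕ→ℚ (S n k) * pow x k)

bell : ℕ → ℚ
bell n = φ n 1ℚ

-- Bernoulli numbers B_n (t/(e^t-1) convention, B_1 = -1/2), via the standard
-- recurrence Σ_{k=0}^{n} C(n+1,k) B_k = 0 (n ≥ 1), B_0 = 1.
-- Bvec n = (B_0, …, B_n).
-- weighted sum Σ_i C(n+2, i) b_i over a vector (b_0, …, b_{m-1}), where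
-- wsum N m j u sums over the last j entries (indices m-j … m-1).
wsum : (N m j : ℕ) → Vec ℚ j → ℚ
wsum N m zero    []       = 0ℚ
wsum N m (suc j) (b ∷ bs) = ℕ→ℚ (N C (m ℕ.∸ suc j)) * b + wsum N m j bs

nextB : (n : ℕ) → Vec ℚ (suc n) → ℚ
nextB n v = - (inv (suc (suc n)) * wsum (suc (suc n)) (suc n) (suc n) v)

Bvec : (n : ℕ) → Vec ℚ (suc n)
Bvec zero    = 1ℚ ∷ []
Bvec (suc n) = Bvec n ∷ʳ nextB n (Bvec n)

Bern : ℕ → ℚ
Bern n = last (Bvec n)

Bplus : ℕ → ℚ
Bplus 1 = ½
Bplus n = Bern n

-- Write T_n(c) = Σ_{j=1}^n S(n,j) c_j, so that φ_m(x) = T_m(x^j) for m ≥ 1.  The heart of the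
-- proof is the identity Σ_{k=0}^n C(n,k) B⁺_{n-k} T_k(c) = n T_n(c_j / j), which holds column by
-- column: j Σ_k C(n,k) B⁺_{n-k} S(k,j) = n S(n,j).  That column identity combines the two
-- expansions S(k+1,j+1) = (j+1) S(k,j+1) + S(k,j) = Σ_i C(k,i) S(i,j) with
-- Σ_k C(n,k) C(k,i) B⁺_{n-k} = C(n,i) (B⁺_{n-i} + n - i), itself a consequence of the Bernoulli
-- recurrence in the form Σ_{k≤N} C(N+1,k) B⁺_k = N+1.  Applying the identity once with
-- c_j = x^j and once with c_j = x^j / j gives the theorem; the Bell case is x = 1.

module Submission where

import Algebra.Properties.Group as GroupProperties
import Data.Integer as ℤ
import Data.Integer.Properties as ℤₚ
open import Data.Nat as ℕ using (ℕ; zero; suc; _≤_; _<_; _∸_; _!; z≤n; s≤s)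
import Data.Nat.Properties as ℕₚ
open import Data.Nat.Combinatorics
  using (_C_; k![n∸k]!∣n!; k>n⇒nCk≡0; nCk+nC[k+1]≡[n+1]C[k+1]; nCk≡nC[n∸k]; nC1≡n; nCn≡1)
open import Data.Nat.Combinatorics.Specification using (nCk≡n!/k![n-k]!)
open import Data.Nat.DivMod using (m/n*n≡m)
import Data.Nat.Solver as ℕ-Solver
open import Data.Product using (_×_; _,_)
open import Data.Rational using (ℚ; 0ℚ; 1ℚ; ½; _+_; _*_; -_; _-_; toℚᵘ)
import Data.Rational.Properties as ℚₚ
import Data.Rational.Solver as ℚ-Solver
import Data.Rational.Unnormalised as ℚᵘ
import Data.Rational.Unnormalised.Properties as ℚᵘₚ
open import Data.Sum using (inj₁; inj₂)
open import Data.Vec using (Vec; []; _∷_; _∷ʳ_)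
open import Data.Vec.Properties using (last-∷ʳ)
open import Relation.Binary.PropositionalEquality
open import Relation.Nullary using (yes; no)

open import Defs

open GroupProperties ℚₚ.+-0-group using () renaming (∙-cancelʳ to +-cancelʳ)

Σ< : ℕ → (ℕ → ℚ) → ℚ
Σ< zero    f = 0ℚ
Σ< (suc n) f = Σ< n f + f n

Σ<-cong : ∀ n {f g : ℕ → ℚ} → (∀ k → k < n → f k ≡ g k) → Σ< n f ≡ Σ< n g
Σ<-cong zero    eq = refl
Σ<-cong (suc n) eq = cong₂ _+_ (Σ<-cong n (λ k k<n → eq k (ℕₚ.m<n⇒m<1+n k<n))) (eq n (ℕₚ.n<1+n n))

Σ<-≡0 : ∀ n {f : ℕ → ℚ} → (∀ k → k < n → f k ≡ 0ℚ) → Σ< n f ≡ 0ℚ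
Σ<-≡0 zero    eq = refl
Σ<-≡0 (suc n) eq = cong₂ _+_ (Σ<-≡0 n (λ k k<n → eq k (ℕₚ.m<n⇒m<1+n k<n))) (eq n (ℕₚ.n<1+n n))

Σ<-distrib-+ : ∀ n (f g : ℕ → ℚ) → Σ< n (λ k → f k + g k) ≡ Σ< n f + Σ< n g
Σ<-distrib-+ zero    f g = refl
Σ<-distrib-+ (suc n) f g = begin
  Σ< n (λ k → f k + g k) + (f n + g n)    ≡⟨ cong (_+ (f n + g n)) (Σ<-distrib-+ n f g) ⟩
  (Σ< n f + Σ< n g) + (f n + g n)         ≡⟨ solve 4 (λ a b c d → (a :+ b) :+ (c :+ d) := (a :+ c) :+ (b :+ d))
                                                     refl (Σ< n f) (Σ< n g) (f n) (g n) ⟩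
  (Σ< n f + f n) + (Σ< n g + g n)         ∎
  where open ≡-Reasoning; open ℚ-Solver.+-*-Solver

*-distribˡ-Σ< : ∀ n c (f : ℕ → ℚ) → c * Σ< n f ≡ Σ< n (λ k → c * f k)
*-distribˡ-Σ< zero    c f = ℚₚ.*-zeroʳ c
*-distribˡ-Σ< (suc n) c f = begin
  c * (Σ< n f + f n)       ≡⟨ ℚₚ.*-distribˡ-+ c (Σ< n f) (f n) ⟩
  c * Σ< n f + c * f n     ≡⟨ cong (_+ c * f n) (*-distribˡ-Σ< n c f) ⟩
  Σ< n (λ k → c * f k) + c * f n ∎
  where open ≡-Reasoning

Σ<-+ : ∀ a b (f : ℕ → ℚ) → Σ< (a ℕ.+ b) f ≡ Σ< a f + Σ< b (λ l → f (a ℕ.+ l))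
Σ<-+ a zero    f rewrite ℕₚ.+-identityʳ a = sym (ℚₚ.+-identityʳ (Σ< a f))
Σ<-+ a (suc b) f rewrite ℕₚ.+-suc a b | Σ<-+ a b f =
  ℚₚ.+-assoc (Σ< a f) (Σ< b (λ l → f (a ℕ.+ l))) (f (a ℕ.+ b))

Σ<-suc : ∀ n (f : ℕ → ℚ) → Σ< (suc n) f ≡ f 0 + Σ< n (λ k → f (suc k))
Σ<-suc n f = trans (Σ<-+ 1 n f) (cong (_+ Σ< n (λ k → f (suc k))) (ℚₚ.+-identityˡ (f 0)))

Σ<-swap : ∀ m n (f : ℕ → ℕ → ℚ) → Σ< m (λ i → Σ< n (f i)) ≡ Σ< n (λ j → Σ< m (λ i → f i j))
Σ<-swap zero    n f = sym (Σ<-≡0 n (λ _ _ → refl))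
Σ<-swap (suc m) n f = begin
  Σ< m (λ i → Σ< n (f i)) + Σ< n (f m)               ≡⟨ cong (_+ Σ< n (f m)) (Σ<-swap m n f) ⟩
  Σ< n (λ j → Σ< m (λ i → f i j)) + Σ< n (f m)       ≡⟨ Σ<-distrib-+ n _ (f m) ⟨
  Σ< n (λ j → Σ< m (λ i → f i j) + f m j)            ∎
  where open ≡-Reasoning

Σ<-extend : ∀ {m n} {f : ℕ → ℚ} → m ≤ n → (∀ k → m ≤ k → k < n → f k ≡ 0ℚ) → Σ< n f ≡ Σ< m f
Σ<-extend {n = zero}          z≤n   vanish = refl
Σ<-extend {m} {suc n} {f} m≤1+n vanish with ℕₚ.m≤n⇒m<n∨m≡n m≤1+n
... | inj₂ refl      = refl
... | inj₁ (s≤s m≤n) = begin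
  Σ< n f + f n       ≡⟨ cong₂ _+_ (Σ<-extend m≤n (λ k m≤k k<n → vanish k m≤k (ℕₚ.m<n⇒m<1+n k<n)))
                                  (vanish n m≤n (ℕₚ.n<1+n n)) ⟩
  Σ< m f + 0ℚ        ≡⟨ ℚₚ.+-identityʳ (Σ< m f) ⟩
  Σ< m f             ∎
  where open ≡-Reasoning

Σ<-reverse : ∀ n (f : ℕ → ℚ) → Σ< n f ≡ Σ< n (λ k → f (n ∸ suc k))
Σ<-reverse zero    f = refl
Σ<-reverse (suc n) f = begin
  Σ< (suc n) f                                   ≡⟨ Σ<-suc n f ⟩
  f 0 + Σ< n (λ k → f (suc k))                   ≡⟨ cong (f 0 +_) (Σ<-reverse n (λ k → f (suc k))) ⟩
  f 0 + Σ< n (λ k → f (suc (n ∸ suc k)))         ≡⟨ ℚₚ.+-comm (f 0) _ ⟩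
  Σ< n (λ k → f (suc (n ∸ suc k))) + f 0         ≡⟨ cong₂ _+_ (Σ<-cong n (λ k k<n → cong f (ℕₚ.+-∸-assoc 1 k<n)))
                                                              (cong f (ℕₚ.n∸n≡0 n)) ⟨
  Σ< (suc n) (λ k → f (suc n ∸ suc k))           ∎
  where open ≡-Reasoning

sum0≡Σ< : ∀ n (f : ℕ → ℚ) → sum0 n f ≡ Σ< (suc n) f
sum0≡Σ< zero    f = sym (ℚₚ.+-identityˡ (f 0))
sum0≡Σ< (suc n) f = cong (_+ f (suc n)) (sum0≡Σ< n f)

sum1≡Σ< : ∀ n (f : ℕ → ℚ) → sum1 n f ≡ Σ< n (λ k → f (suc k))
sum1≡Σ< zero    f = refl
sum1≡Σ< (suc n) f = cong (_+ f (suc n)) (sum1≡Σ< n f)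

sum1≡Σ<-from-0 : ∀ n (f : ℕ → ℚ) → f 0 ≡ 0ℚ → sum1 n f ≡ Σ< (suc n) f
sum1≡Σ<-from-0 n f f0≡0 = begin
  sum1 n f                              ≡⟨ sum1≡Σ< n f ⟩
  Σ< n (λ k → f (suc k))                ≡⟨ ℚₚ.+-identityˡ _ ⟨
  0ℚ + Σ< n (λ k → f (suc k))           ≡⟨ cong (_+ Σ< n (λ k → f (suc k))) f0≡0 ⟨
  f 0 + Σ< n (λ k → f (suc k))          ≡⟨ Σ<-suc n f ⟨
  Σ< (suc n) f                          ∎
  where open ≡-Reasoning

sum1-cong : ∀ n {f g : ℕ → ℚ} → (∀ k → f (suc k) ≡ g (suc k)) → sum1 n f ≡ sum1 n g
sum1-cong zero    eq = refl
sum1-cong (suc n) eq = cong₂ _+_ (sum1-cong n eq) (eq n)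

toℚᵘ-ℕ→ℚ : ∀ n → toℚᵘ (ℕ→ℚ n) ℚᵘ.≃ ℚᵘ.mkℚᵘ (ℤ.+ n) 0
toℚᵘ-ℕ→ℚ n = ℚₚ.toℚᵘ-fromℚᵘ (ℚᵘ.mkℚᵘ (ℤ.+ n) 0)

ℕ→ℚ-+ : ∀ a b → ℕ→ℚ (a ℕ.+ b) ≡ ℕ→ℚ a + ℕ→ℚ b
ℕ→ℚ-+ a b = ℚₚ.toℚᵘ-injective (begin-equality
  toℚᵘ (ℕ→ℚ (a ℕ.+ b))                    ≃⟨ toℚᵘ-ℕ→ℚ (a ℕ.+ b) ⟩
  ℚᵘ.mkℚᵘ (ℤ.+ (a ℕ.+ b)) 0              ≃⟨ ℚᵘ.*≡* (cong (ℤ._* ℤ.+ 1) sum-numerator) ⟩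
  ℚᵘ.mkℚᵘ (ℤ.+ a) 0 ℚᵘ.+ ℚᵘ.mkℚᵘ (ℤ.+ b) 0 ≃⟨ ℚᵘₚ.+-cong (toℚᵘ-ℕ→ℚ a) (toℚᵘ-ℕ→ℚ b) ⟨
  toℚᵘ (ℕ→ℚ a) ℚᵘ.+ toℚᵘ (ℕ→ℚ b)          ≃⟨ ℚₚ.toℚᵘ-homo-+ (ℕ→ℚ a) (ℕ→ℚ b) ⟨
  toℚᵘ (ℕ→ℚ a + ℕ→ℚ b)                    ∎)
  where
  open ℚᵘₚ.≤-Reasoning
  sum-numerator : ℤ.+ (a ℕ.+ b) ≡ ℤ.+ a ℤ.* ℤ.+ 1 ℤ.+ ℤ.+ b ℤ.* ℤ.+ 1
  sum-numerator = trans (ℤₚ.pos-+ a b) (sym (cong₂ ℤ._+_ (ℤₚ.*-identityʳ (ℤ.+ a)) (ℤₚ.*-identityʳ (ℤ.+ b))))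

ℕ→ℚ-* : ∀ a b → ℕ→ℚ (a ℕ.* b) ≡ ℕ→ℚ a * ℕ→ℚ b
ℕ→ℚ-* zero    b = sym (ℚₚ.*-zeroˡ (ℕ→ℚ b))
ℕ→ℚ-* (suc a) b = begin
  ℕ→ℚ (b ℕ.+ a ℕ.* b)          ≡⟨ ℕ→ℚ-+ b (a ℕ.* b) ⟩
  ℕ→ℚ b + ℕ→ℚ (a ℕ.* b)        ≡⟨ cong (ℕ→ℚ b +_) (ℕ→ℚ-* a b) ⟩
  ℕ→ℚ b + ℕ→ℚ a * ℕ→ℚ b        ≡⟨ solve 2 (λ a b → b :+ a :* b := (con 1ℚ :+ a) :* b) refl (ℕ→ℚ a) (ℕ→ℚ b) ⟩
  (1ℚ + ℕ→ℚ a) * ℕ→ℚ b         ≡⟨ cong (_* ℕ→ℚ b) (ℕ→ℚ-+ 1 a) ⟨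
  ℕ→ℚ (suc a) * ℕ→ℚ b          ∎
  where open ≡-Reasoning; open ℚ-Solver.+-*-Solver

inv-inverseˡ : ∀ k → inv (suc k) * ℕ→ℚ (suc k) ≡ 1ℚ
inv-inverseˡ k = ℚₚ.toℚᵘ-injective (begin-equality
  toℚᵘ (inv (suc k) * ℕ→ℚ (suc k))                  ≃⟨ ℚₚ.toℚᵘ-homo-* (inv (suc k)) (ℕ→ℚ (suc k)) ⟩
  toℚᵘ (inv (suc k)) ℚᵘ.* toℚᵘ (ℕ→ℚ (suc k))        ≃⟨ ℚᵘₚ.*-cong (ℚₚ.toℚᵘ-fromℚᵘ (ℚᵘ.mkℚᵘ (ℤ.+ 1) k))
                                                                   (toℚᵘ-ℕ→ℚ (suc k)) ⟩
  ℚᵘ.mkℚᵘ (ℤ.+ 1) k ℚᵘ.* ℚᵘ.mkℚᵘ (ℤ.+ suc k) 0      ≃⟨ ℚᵘ.*≡* cross-product ⟩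
  toℚᵘ 1ℚ                                           ∎)
  where
  open ℚᵘₚ.≤-Reasoning
  cross-product : (ℤ.+ 1 ℤ.* ℤ.+ suc k) ℤ.* ℤ.+ 1 ≡ ℤ.+ 1 ℤ.* ℤ.+ (suc k ℕ.* 1)
  cross-product rewrite ℕₚ.*-identityʳ k | ℤₚ.*-identityʳ (ℤ.+ 1 ℤ.* ℤ.+ suc k) = refl

inv-cancelˡ : ∀ k q → inv (suc k) * (ℕ→ℚ (suc k) * q) ≡ q
inv-cancelˡ k q = begin
  inv (suc k) * (ℕ→ℚ (suc k) * q)   ≡⟨ ℚₚ.*-assoc (inv (suc k)) (ℕ→ℚ (suc k)) q ⟨
  inv (suc k) * ℕ→ℚ (suc k) * q     ≡⟨ cong (_* q) (inv-inverseˡ k) ⟩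
  1ℚ * q                            ≡⟨ ℚₚ.*-identityˡ q ⟩
  q                                 ∎
  where open ≡-Reasoning

pow-1ℚ : ∀ k → pow 1ℚ k ≡ 1ℚ
pow-1ℚ zero    = refl
pow-1ℚ (suc k) = cong (_* 1ℚ) (pow-1ℚ k)

nCk*[k!*[n∸k]!]≡n! : ∀ {n k} → k ≤ n → (n C k) ℕ.* (k ! ℕ.* (n ∸ k) !) ≡ n !
nCk*[k!*[n∸k]!]≡n! {n} {k} k≤n =
  trans (cong (ℕ._* (k ! ℕ.* (n ∸ k) !)) (nCk≡n!/k![n-k]! k≤n)) (m/n*n≡m (k![n∸k]!∣n! k≤n))
  where instance _ = k ℕₚ.!* (n ∸ k) !≢0

[1+n]Cn≡1+n : ∀ n → suc n C n ≡ suc n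
[1+n]Cn≡1+n n = begin
  suc n C n               ≡⟨ nCk≡nC[n∸k] (ℕₚ.n≤1+n n) ⟩
  suc n C (suc n ∸ n)     ≡⟨ cong (suc n C_) (ℕₚ.m+n∸n≡m 1 n) ⟩
  suc n C 1               ≡⟨ nC1≡n (suc n) ⟩
  suc n                   ∎
  where open ≡-Reasoning

[1+m]Ci*[1+m∸i]≡[1+m]*mCi : ∀ m i → (suc m C i) ℕ.* (suc m ∸ i) ≡ suc m ℕ.* (m C i)
[1+m]Ci*[1+m∸i]≡[1+m]*mCi m i with i ℕ.≤? m
... | no i≰m = begin
  (suc m C i) ℕ.* (suc m ∸ i)   ≡⟨ cong ((suc m C i) ℕ.*_) (ℕₚ.m≤n⇒m∸n≡0 (ℕₚ.≰⇒> i≰m)) ⟩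
  (suc m C i) ℕ.* 0             ≡⟨ ℕₚ.*-zeroʳ (suc m C i) ⟩
  0                             ≡⟨ ℕₚ.*-zeroʳ (suc m) ⟨
  suc m ℕ.* 0                   ≡⟨ cong (suc m ℕ.*_) (k>n⇒nCk≡0 (ℕₚ.≰⇒> i≰m)) ⟨
  suc m ℕ.* (m C i)             ∎
  where open ≡-Reasoning
... | yes i≤m = ℕₚ.*-cancelʳ-≡ _ _ (i ! ℕ.* (m ∸ i) !) {{i ℕₚ.!* (m ∸ i) !≢0}} (begin
  (suc m C i) ℕ.* (suc m ∸ i) ℕ.* (i ! ℕ.* (m ∸ i) !)
    ≡⟨ cong (λ z → (suc m C i) ℕ.* z ℕ.* (i ! ℕ.* (m ∸ i) !)) 1+m∸i≡1+[m∸i] ⟩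
  (suc m C i) ℕ.* suc (m ∸ i) ℕ.* (i ! ℕ.* (m ∸ i) !)
    ≡⟨ solve 4 (λ c s a b → c :* (con 1 :+ s) :* (a :* b) := c :* (a :* (b :+ s :* b)))
             refl (suc m C i) (m ∸ i) (i !) ((m ∸ i) !) ⟩
  (suc m C i) ℕ.* (i ! ℕ.* suc (m ∸ i) !)
    ≡⟨ cong (λ z → (suc m C i) ℕ.* (i ! ℕ.* z !)) 1+m∸i≡1+[m∸i] ⟨
  (suc m C i) ℕ.* (i ! ℕ.* (suc m ∸ i) !)
    ≡⟨ nCk*[k!*[n∸k]!]≡n! (ℕₚ.m≤n⇒m≤1+n i≤m) ⟩
  suc m !
    ≡⟨ cong (λ z → z ℕ.+ m ℕ.* z) (nCk*[k!*[n∸k]!]≡n! i≤m) ⟨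
  (m C i) ℕ.* (i ! ℕ.* (m ∸ i) !) ℕ.+ m ℕ.* ((m C i) ℕ.* (i ! ℕ.* (m ∸ i) !))
    ≡⟨ solve 4 (λ m c a b → c :* (a :* b) :+ m :* (c :* (a :* b)) := (con 1 :+ m) :* c :* (a :* b))
             refl m (m C i) (i !) ((m ∸ i) !) ⟩
  suc m ℕ.* (m C i) ℕ.* (i ! ℕ.* (m ∸ i) !)
    ∎)
  where
  open ≡-Reasoning
  open ℕ-Solver.+-*-Solver
  1+m∸i≡1+[m∸i] : suc m ∸ i ≡ suc (m ∸ i)
  1+m∸i≡1+[m∸i] = ℕₚ.+-∸-assoc 1 i≤m

[i+n]C[i+l]*[i+l]Ci≡[i+n]Ci*nCl : ∀ i n l → l ≤ n →
  ((i ℕ.+ n) C (i ℕ.+ l)) ℕ.* ((i ℕ.+ l) C i) ≡ ((i ℕ.+ n) C i) ℕ.* (n C l)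
[i+n]C[i+l]*[i+l]Ci≡[i+n]Ci*nCl i n l l≤n =
  ℕₚ.*-cancelʳ-≡ _ _ (i ! ℕ.* l ! ℕ.* (n ∸ l) !) {{denominator≢0}} (begin
  A ℕ.* B ℕ.* (i ! ℕ.* l ! ℕ.* (n ∸ l) !)
    ≡⟨ solve 5 (λ A B a b c → A :* B :* (a :* b :* c) := A :* ((B :* (a :* b)) :* c))
             refl A B (i !) (l !) ((n ∸ l) !) ⟩
  A ℕ.* ((B ℕ.* (i ! ℕ.* l !)) ℕ.* (n ∸ l) !)
    ≡⟨ cong (λ z → A ℕ.* (B ℕ.* (i ! ℕ.* z !) ℕ.* (n ∸ l) !)) (ℕₚ.m+n∸m≡n i l) ⟨
  A ℕ.* ((B ℕ.* (i ! ℕ.* ((i ℕ.+ l) ∸ i) !)) ℕ.* (n ∸ l) !)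
    ≡⟨ cong (λ z → A ℕ.* (z ℕ.* (n ∸ l) !)) (nCk*[k!*[n∸k]!]≡n! (ℕₚ.m≤m+n i l)) ⟩
  A ℕ.* ((i ℕ.+ l) ! ℕ.* (n ∸ l) !)
    ≡⟨ cong (λ z → A ℕ.* ((i ℕ.+ l) ! ℕ.* z !)) (ℕₚ.[m+n]∸[m+o]≡n∸o i n l) ⟨
  A ℕ.* ((i ℕ.+ l) ! ℕ.* ((i ℕ.+ n) ∸ (i ℕ.+ l)) !)
    ≡⟨ nCk*[k!*[n∸k]!]≡n! (ℕₚ.+-monoʳ-≤ i l≤n) ⟩
  (i ℕ.+ n) !
    ≡⟨ nCk*[k!*[n∸k]!]≡n! (ℕₚ.m≤m+n i n) ⟨
  A′ ℕ.* (i ! ℕ.* ((i ℕ.+ n) ∸ i) !)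
    ≡⟨ cong (λ z → A′ ℕ.* (i ! ℕ.* z !)) (ℕₚ.m+n∸m≡n i n) ⟩
  A′ ℕ.* (i ! ℕ.* n !)
    ≡⟨ cong (λ z → A′ ℕ.* (i ! ℕ.* z)) (nCk*[k!*[n∸k]!]≡n! l≤n) ⟨
  A′ ℕ.* (i ! ℕ.* (B′ ℕ.* (l ! ℕ.* (n ∸ l) !)))
    ≡⟨ solve 5 (λ A B a b c → A :* (a :* (B :* (b :* c))) := A :* B :* (a :* b :* c))
             refl A′ B′ (i !) (l !) ((n ∸ l) !) ⟩
  A′ ℕ.* B′ ℕ.* (i ! ℕ.* l ! ℕ.* (n ∸ l) !)
    ∎)
  where
  open ≡-Reasoning
  open ℕ-Solver.+-*-Solver
  A  = (i ℕ.+ n) C (i ℕ.+ l)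
  B  = (i ℕ.+ l) C i
  A′ = (i ℕ.+ n) C i
  B′ = n C l
  denominator≢0 : ℕ.NonZero (i ! ℕ.* l ! ℕ.* (n ∸ l) !)
  denominator≢0 = ℕₚ.m*n≢0 (i ! ℕ.* l !) ((n ∸ l) !) {{i ℕₚ.!* l !≢0}} {{(n ∸ l) ℕₚ.!≢0}}

Cℚ : ℕ → ℕ → ℚ
Cℚ n k = ℕ→ℚ (n C k)

Cℚ-pascal : ∀ n k → Cℚ (suc n) (suc k) ≡ Cℚ n k + Cℚ n (suc k)
Cℚ-pascal n k = trans (cong ℕ→ℚ (sym (nCk+nC[k+1]≡[n+1]C[k+1] n k))) (ℕ→ℚ-+ (n C k) (n C suc k))

n<k⇒Cℚ[n,k]≡0 : ∀ {n k} → n < k → Cℚ n k ≡ 0ℚ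
n<k⇒Cℚ[n,k]≡0 n<k = cong ℕ→ℚ (k>n⇒nCk≡0 n<k)

Σ<-C-pascal : ∀ m (a : ℕ → ℚ) →
  Σ< (suc (suc m)) (λ i → Cℚ (suc m) i * a i)
  ≡ Σ< (suc m) (λ i → Cℚ m i * a i) + Σ< (suc m) (λ i → Cℚ m i * a (suc i))
Σ<-C-pascal m a = begin
  Σ< (suc (suc m)) (λ i → Cℚ (suc m) i * a i)
    ≡⟨ Σ<-suc (suc m) _ ⟩
  1ℚ * a 0 + Σ< (suc m) (λ i → Cℚ (suc m) (suc i) * a (suc i))
    ≡⟨ cong (1ℚ * a 0 +_) (Σ<-cong (suc m) (λ i _ → split i)) ⟩
  1ℚ * a 0 + Σ< (suc m) (λ i → Cℚ m (suc i) * a (suc i) + Cℚ m i * a (suc i))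
    ≡⟨ cong (1ℚ * a 0 +_) (Σ<-distrib-+ (suc m) _ _) ⟩
  1ℚ * a 0 + (Σ< (suc m) (λ i → Cℚ m (suc i) * a (suc i)) + shifted)
    ≡⟨ ℚₚ.+-assoc (1ℚ * a 0) _ shifted ⟨
  (1ℚ * a 0 + Σ< (suc m) (λ i → Cℚ m (suc i) * a (suc i))) + shifted
    ≡⟨ cong (_+ shifted) (Σ<-suc (suc m) (λ i → Cℚ m i * a i)) ⟨
  (Σ< (suc m) (λ i → Cℚ m i * a i) + Cℚ m (suc m) * a (suc m)) + shifted
    ≡⟨ cong (λ c → (Σ< (suc m) (λ i → Cℚ m i * a i) + c * a (suc m)) + shifted)
            (n<k⇒Cℚ[n,k]≡0 (ℕₚ.n<1+n m)) ⟩
  (Σ< (suc m) (λ i → Cℚ m i * a i) + 0ℚ * a (suc m)) + shifted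
    ≡⟨ cong (_+ shifted) (solve 2 (λ r x → r :+ con 0ℚ :* x := r) refl
                                  (Σ< (suc m) (λ i → Cℚ m i * a i)) (a (suc m))) ⟩
  Σ< (suc m) (λ i → Cℚ m i * a i) + shifted
    ∎
  where
  open ≡-Reasoning
  open ℚ-Solver.+-*-Solver
  shifted = Σ< (suc m) (λ i → Cℚ m i * a (suc i))
  split : ∀ i → Cℚ (suc m) (suc i) * a (suc i) ≡ Cℚ m (suc i) * a (suc i) + Cℚ m i * a (suc i)
  split i = begin
    Cℚ (suc m) (suc i) * a (suc i)                     ≡⟨ cong (_* a (suc i)) (Cℚ-pascal m i) ⟩
    (Cℚ m i + Cℚ m (suc i)) * a (suc i)                ≡⟨ ℚₚ.*-distribʳ-+ (a (suc i)) (Cℚ m i) _ ⟩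
    Cℚ m i * a (suc i) + Cℚ m (suc i) * a (suc i)      ≡⟨ ℚₚ.+-comm (Cℚ m i * a (suc i)) _ ⟩
    Cℚ m (suc i) * a (suc i) + Cℚ m i * a (suc i)      ∎

Σ<-C*[n∸i] : ∀ m (a : ℕ → ℚ) →
  Σ< (suc (suc m)) (λ i → Cℚ (suc m) i * (ℕ→ℚ (suc m ∸ i) * a i))
  ≡ ℕ→ℚ (suc m) * Σ< (suc m) (λ i → Cℚ m i * a i)
Σ<-C*[n∸i] m a = begin
  Σ< (suc (suc m)) (λ i → Cℚ (suc m) i * (ℕ→ℚ (suc m ∸ i) * a i))
    ≡⟨ Σ<-cong (suc (suc m)) (λ i _ → absorb i) ⟩
  Σ< (suc (suc m)) (λ i → ℕ→ℚ (suc m) * (Cℚ m i * a i))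
    ≡⟨ *-distribˡ-Σ< (suc (suc m)) (ℕ→ℚ (suc m)) _ ⟨
  ℕ→ℚ (suc m) * Σ< (suc (suc m)) (λ i → Cℚ m i * a i)
    ≡⟨ cong (ℕ→ℚ (suc m) *_) (Σ<-extend (ℕₚ.n≤1+n (suc m)) (λ i m<i _ →
         trans (cong (_* a i) (n<k⇒Cℚ[n,k]≡0 m<i)) (ℚₚ.*-zeroˡ (a i)))) ⟩
  ℕ→ℚ (suc m) * Σ< (suc m) (λ i → Cℚ m i * a i)
    ∎
  where
  open ≡-Reasoning
  absorb : ∀ i → Cℚ (suc m) i * (ℕ→ℚ (suc m ∸ i) * a i) ≡ ℕ→ℚ (suc m) * (Cℚ m i * a i)
  absorb i = begin
    Cℚ (suc m) i * (ℕ→ℚ (suc m ∸ i) * a i)        ≡⟨ ℚₚ.*-assoc (Cℚ (suc m) i) _ (a i) ⟨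
    Cℚ (suc m) i * ℕ→ℚ (suc m ∸ i) * a i          ≡⟨ cong (_* a i) (ℕ→ℚ-* (suc m C i) (suc m ∸ i)) ⟨
    ℕ→ℚ ((suc m C i) ℕ.* (suc m ∸ i)) * a i       ≡⟨ cong (λ z → ℕ→ℚ z * a i) ([1+m]Ci*[1+m∸i]≡[1+m]*mCi m i) ⟩
    ℕ→ℚ (suc m ℕ.* (m C i)) * a i                 ≡⟨ cong (_* a i) (ℕ→ℚ-* (suc m) (m C i)) ⟩
    ℕ→ℚ (suc m) * Cℚ m i * a i                    ≡⟨ ℚₚ.*-assoc (ℕ→ℚ (suc m)) (Cℚ m i) (a i) ⟩
    ℕ→ℚ (suc m) * (Cℚ m i * a i)                  ∎

Sℚ : ℕ → ℕ → ℚ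
Sℚ n k = ℕ→ℚ (S n k)

k<j⇒S[k,j]≡0 : ∀ {k j} → k < j → S k j ≡ 0
k<j⇒S[k,j]≡0 {zero}  {suc j} _ = refl
k<j⇒S[k,j]≡0 {suc k} {suc j} (s≤s k<j)
  rewrite k<j⇒S[k,j]≡0 (ℕₚ.m<n⇒m<1+n k<j) | k<j⇒S[k,j]≡0 k<j | ℕₚ.*-zeroʳ j = refl

k<j⇒Sℚ[k,j]≡0 : ∀ {k j} → k < j → Sℚ k j ≡ 0ℚ
k<j⇒Sℚ[k,j]≡0 k<j = cong ℕ→ℚ (k<j⇒S[k,j]≡0 k<j)

Sℚ-suc-suc : ∀ k j → Sℚ (suc k) (suc j) ≡ ℕ→ℚ (suc j) * Sℚ k (suc j) + Sℚ k j
Sℚ-suc-suc k j = trans (ℕ→ℚ-+ (suc j ℕ.* S k (suc j)) (S k j))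
                       (cong (_+ Sℚ k j) (ℕ→ℚ-* (suc j) (S k (suc j))))

Sℚ-binomial : ∀ n j → Sℚ (suc n) (suc j) ≡ Σ< (suc n) (λ i → Cℚ n i * Sℚ i j)
Sℚ-binomial zero j rewrite ℕₚ.*-zeroʳ j = solve 1 (λ s → s := con 0ℚ :+ con 1ℚ :* s) refl (Sℚ 0 j)
  where open ℚ-Solver.+-*-Solver
Sℚ-binomial (suc m) zero = begin
  Sℚ (suc (suc m)) 1                                    ≡⟨ Sℚ-suc-suc (suc m) 0 ⟩
  1ℚ * Sℚ (suc m) 1 + 0ℚ                                ≡⟨ solve 1 (λ s → con 1ℚ :* s :+ con 0ℚ := s) refl (Sℚ (suc m) 1) ⟩
  Sℚ (suc m) 1                                          ≡⟨ ℚₚ.+-identityʳ (Sℚ (suc m) 1) ⟨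
  Sℚ (suc m) 1 + 0ℚ                                     ≡⟨ cong₂ _+_ (Sℚ-binomial m 0)
                                                                   (sym (Σ<-≡0 (suc m) (λ i _ → ℚₚ.*-zeroʳ (Cℚ m i)))) ⟩
  R m 0 + Σ< (suc m) (λ i → Cℚ m i * Sℚ (suc i) 0)      ≡⟨ Σ<-C-pascal m (λ i → Sℚ i 0) ⟨
  R (suc m) 0                                           ∎
  where
  open ≡-Reasoning
  open ℚ-Solver.+-*-Solver
  R : ℕ → ℕ → ℚ
  R m j = Σ< (suc m) (λ i → Cℚ m i * Sℚ i j)
Sℚ-binomial (suc m) (suc j) = begin
  Sℚ (suc (suc m)) (suc (suc j))                        ≡⟨ Sℚ-suc-suc (suc m) (suc j) ⟩
  ℕ→ℚ (suc (suc j)) * Sℚ (suc m) (suc (suc j)) + Sℚ (suc m) (suc j)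
                                                        ≡⟨ cong₂ (λ u v → ℕ→ℚ (suc (suc j)) * u + v)
                                                                 (Sℚ-binomial m (suc j)) (Sℚ-binomial m j) ⟩
  ℕ→ℚ (suc (suc j)) * R m (suc j) + R m j               ≡⟨ cong (λ c → c * R m (suc j) + R m j) (ℕ→ℚ-+ 1 (suc j)) ⟩
  (1ℚ + c) * R m (suc j) + R m j                        ≡⟨ solve 3 (λ c r r′ → (con 1ℚ :+ c) :* r :+ r′ := r :+ (c :* r :+ r′))
                                                                 refl c (R m (suc j)) (R m j) ⟩
  R m (suc j) + (c * R m (suc j) + R m j)               ≡⟨ cong (R m (suc j) +_) shifted-column ⟨
  R m (suc j) + Σ< (suc m) (λ i → Cℚ m i * Sℚ (suc i) (suc j))
                                                        ≡⟨ Σ<-C-pascal m (λ i → Sℚ i (suc j)) ⟨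
  R (suc m) (suc j)                                     ∎
  where
  open ≡-Reasoning
  open ℚ-Solver.+-*-Solver
  c = ℕ→ℚ (suc j)
  R : ℕ → ℕ → ℚ
  R m j = Σ< (suc m) (λ i → Cℚ m i * Sℚ i j)
  shifted-column : Σ< (suc m) (λ i → Cℚ m i * Sℚ (suc i) (suc j)) ≡ c * R m (suc j) + R m j
  shifted-column = begin
    Σ< (suc m) (λ i → Cℚ m i * Sℚ (suc i) (suc j))
      ≡⟨ Σ<-cong (suc m) (λ i _ → trans (cong (Cℚ m i *_) (Sℚ-suc-suc i j))
                                        (ℚₚ.*-distribˡ-+ (Cℚ m i) _ (Sℚ i j))) ⟩
    Σ< (suc m) (λ i → Cℚ m i * (c * Sℚ i (suc j)) + Cℚ m i * Sℚ i j)
      ≡⟨ Σ<-distrib-+ (suc m) _ _ ⟩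
    Σ< (suc m) (λ i → Cℚ m i * (c * Sℚ i (suc j))) + R m j
      ≡⟨ cong (_+ R m j) (Σ<-cong (suc m) (λ i _ →
           solve 3 (λ a b d → a :* (b :* d) := b :* (a :* d)) refl (Cℚ m i) c (Sℚ i (suc j)))) ⟩
    Σ< (suc m) (λ i → c * (Cℚ m i * Sℚ i (suc j))) + R m j
      ≡⟨ cong (_+ R m j) (*-distribˡ-Σ< (suc m) c _) ⟨
    c * R m (suc j) + R m j
      ∎

wsum-∷ʳ : ∀ N m j (v : Vec ℚ j) x → wsum N (suc m) (suc j) (v ∷ʳ x) ≡ wsum N m j v + Cℚ N m * x
wsum-∷ʳ N m zero    []       x = ℚₚ.+-comm (Cℚ N m * x) 0ℚ
wsum-∷ʳ N m (suc j) (b ∷ bs) x rewrite wsum-∷ʳ N m j bs x =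
  sym (ℚₚ.+-assoc (Cℚ N (m ∸ suc j) * b) (wsum N m j bs) (Cℚ N m * x))

wsum-Bvec : ∀ N n → wsum N (suc n) (suc n) (Bvec n) ≡ Σ< (suc n) (λ i → Cℚ N i * Bern i)
wsum-Bvec N zero    = solve 1 (λ c → c :* con 1ℚ :+ con 0ℚ := con 0ℚ :+ c :* con 1ℚ) refl (Cℚ N 0)
  where open ℚ-Solver.+-*-Solver
wsum-Bvec N (suc n) = trans (wsum-∷ʳ N (suc n) (suc n) (Bvec n) (nextB n (Bvec n)))
  (cong₂ (λ u v → u + Cℚ N (suc n) * v) (wsum-Bvec N n) (sym (last-∷ʳ (nextB n (Bvec n)) (Bvec n))))

Σ<-C*Bern≡0 : ∀ n → Σ< (suc (suc n)) (λ i → Cℚ (suc (suc n)) i * Bern i) ≡ 0ℚ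
Σ<-C*Bern≡0 n = begin
  T + Cℚ (suc (suc n)) (suc n) * Bern (suc n)
    ≡⟨ cong₂ (λ u v → T + ℕ→ℚ u * v) ([1+n]Cn≡1+n (suc n)) (last-∷ʳ (nextB n (Bvec n)) (Bvec n)) ⟩
  T + N * (- (inv (suc (suc n)) * wsum (suc (suc n)) (suc n) (suc n) (Bvec n)))
    ≡⟨ cong (λ v → T + N * (- (inv (suc (suc n)) * v))) (wsum-Bvec (suc (suc n)) n) ⟩
  T + N * (- (inv (suc (suc n)) * T))
    ≡⟨ solve 3 (λ t a b → t :+ a :* (:- (b :* t)) := t :- (b :* a) :* t) refl T N (inv (suc (suc n))) ⟩
  T - (inv (suc (suc n)) * N) * T
    ≡⟨ cong (λ z → T - z * T) (inv-inverseˡ (suc n)) ⟩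
  T - 1ℚ * T
    ≡⟨ solve 1 (λ t → t :- con 1ℚ :* t := con 0ℚ) refl T ⟩
  0ℚ
    ∎
  where
  open ≡-Reasoning
  open ℚ-Solver.+-*-Solver
  T = Σ< (suc n) (λ i → Cℚ (suc (suc n)) i * Bern i)
  N = ℕ→ℚ (suc (suc n))

-- B⁺ and B differ only at index 1, by B⁺₁ - B₁ = 1.
Σ<-C*Bplus : ∀ n → Σ< (suc n) (λ k → Cℚ (suc n) k * Bplus k) ≡ ℕ→ℚ (suc n)
Σ<-C*Bplus zero    = refl
Σ<-C*Bplus (suc m) = begin
  Σ< (2 ℕ.+ m) (λ k → Cℚ N k * Bplus k)
    ≡⟨ Σ<-+ 2 m (λ k → Cℚ N k * Bplus k) ⟩
  ((0ℚ + Cℚ N 0 * 1ℚ) + Cℚ N 1 * ½) + tail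
    ≡⟨ solve 3 (λ c₀ c₁ t → ((con 0ℚ :+ c₀ :* con 1ℚ) :+ c₁ :* con ½) :+ t
                           := (((con 0ℚ :+ c₀ :* con 1ℚ) :+ c₁ :* con (- ½)) :+ t) :+ c₁)
             refl (Cℚ N 0) (Cℚ N 1) tail ⟩
  (((0ℚ + Cℚ N 0 * 1ℚ) + Cℚ N 1 * (- ½)) + tail) + Cℚ N 1
    ≡⟨ cong (_+ Cℚ N 1) (trans (sym (Σ<-+ 2 m (λ k → Cℚ N k * Bern k))) (Σ<-C*Bern≡0 m)) ⟩
  0ℚ + Cℚ N 1
    ≡⟨ ℚₚ.+-identityˡ (Cℚ N 1) ⟩
  Cℚ N 1
    ≡⟨ cong ℕ→ℚ (nC1≡n N) ⟩
  ℕ→ℚ N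
    ∎
  where
  open ≡-Reasoning
  open ℚ-Solver.+-*-Solver
  N = suc (suc m)
  tail = Σ< m (λ l → Cℚ N (2 ℕ.+ l) * Bern (2 ℕ.+ l))

Σ<-C*Bplus-reflected : ∀ n → Σ< (suc n) (λ k → Cℚ n k * Bplus (n ∸ k)) ≡ Bplus n + ℕ→ℚ n
Σ<-C*Bplus-reflected zero    = refl
Σ<-C*Bplus-reflected (suc m) = begin
  Σ< (suc (suc m)) (λ k → Cℚ (suc m) k * Bplus (suc m ∸ k))
    ≡⟨ Σ<-reverse (suc (suc m)) _ ⟩
  Σ< (suc (suc m)) (λ k → Cℚ (suc m) (suc m ∸ k) * Bplus (suc m ∸ (suc m ∸ k)))
    ≡⟨ Σ<-cong (suc (suc m)) (λ k k<2+m → cong₂ (λ u v → ℕ→ℚ u * Bplus v)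
                                               (sym (nCk≡nC[n∸k] (ℕₚ.≤-pred k<2+m)))
                                               (ℕₚ.m∸[m∸n]≡n (ℕₚ.≤-pred k<2+m))) ⟩
  Σ< (suc m) (λ k → Cℚ (suc m) k * Bplus k) + Cℚ (suc m) (suc m) * Bplus (suc m)
    ≡⟨ cong₂ (λ u v → u + ℕ→ℚ v * Bplus (suc m)) (Σ<-C*Bplus m) (nCn≡1 (suc m)) ⟩
  ℕ→ℚ (suc m) + 1ℚ * Bplus (suc m)
    ≡⟨ solve 2 (λ n b → n :+ con 1ℚ :* b := b :+ n) refl (ℕ→ℚ (suc m)) (Bplus (suc m)) ⟩
  Bplus (suc m) + ℕ→ℚ (suc m)
    ∎
  where
  open ≡-Reasoning
  open ℚ-Solver.+-*-Solver

Σ<-C*C*Bplus : ∀ {n i} → i ≤ n →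
  Σ< (suc n) (λ k → Cℚ n k * (Cℚ k i * Bplus (n ∸ k))) ≡ Cℚ n i * (Bplus (n ∸ i) + ℕ→ℚ (n ∸ i))
Σ<-C*C*Bplus {n} {i} i≤n = subst
  (λ n′ → Σ< (suc n′) (λ k → Cℚ n′ k * (Cℚ k i * Bplus (n′ ∸ k)))
          ≡ Cℚ n′ i * (Bplus (n ∸ i) + ℕ→ℚ (n ∸ i)))
  (ℕₚ.m+[n∸m]≡n i≤n) (at-i+ (n ∸ i))
  where
  open ≡-Reasoning
  open ℚ-Solver.+-*-Solver
  at-i+ : ∀ d → Σ< (suc (i ℕ.+ d)) (λ k → Cℚ (i ℕ.+ d) k * (Cℚ k i * Bplus ((i ℕ.+ d) ∸ k)))
                ≡ Cℚ (i ℕ.+ d) i * (Bplus d + ℕ→ℚ d)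
  at-i+ d = begin
    Σ< (suc (i ℕ.+ d)) f                         ≡⟨ cong (λ z → Σ< z f) (ℕₚ.+-suc i d) ⟨
    Σ< (i ℕ.+ suc d) f                           ≡⟨ Σ<-+ i (suc d) f ⟩
    Σ< i f + Σ< (suc d) (λ l → f (i ℕ.+ l))      ≡⟨ cong₂ _+_ (Σ<-≡0 i below-i)
                                                              (Σ<-cong (suc d) (λ l l<1+d → term l (ℕₚ.≤-pred l<1+d))) ⟩
    0ℚ + Σ< (suc d) (λ l → Cℚ (i ℕ.+ d) i * (Cℚ d l * Bplus (d ∸ l)))
                                                 ≡⟨ ℚₚ.+-identityˡ _ ⟩
    Σ< (suc d) (λ l → Cℚ (i ℕ.+ d) i * (Cℚ d l * Bplus (d ∸ l)))
                                                 ≡⟨ *-distribˡ-Σ< (suc d) (Cℚ (i ℕ.+ d) i) _ ⟨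
    Cℚ (i ℕ.+ d) i * Σ< (suc d) (λ l → Cℚ d l * Bplus (d ∸ l))
                                                 ≡⟨ cong (Cℚ (i ℕ.+ d) i *_) (Σ<-C*Bplus-reflected d) ⟩
    Cℚ (i ℕ.+ d) i * (Bplus d + ℕ→ℚ d)           ∎
    where
    f : ℕ → ℚ
    f k = Cℚ (i ℕ.+ d) k * (Cℚ k i * Bplus ((i ℕ.+ d) ∸ k))
    below-i : ∀ k → k < i → f k ≡ 0ℚ
    below-i k k<i = begin
      Cℚ (i ℕ.+ d) k * (Cℚ k i * Bplus ((i ℕ.+ d) ∸ k)) ≡⟨ cong (λ c → Cℚ (i ℕ.+ d) k * (c * Bplus ((i ℕ.+ d) ∸ k)))
                                                                 (n<k⇒Cℚ[n,k]≡0 k<i) ⟩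
      Cℚ (i ℕ.+ d) k * (0ℚ * Bplus ((i ℕ.+ d) ∸ k))     ≡⟨ solve 2 (λ a b → a :* (con 0ℚ :* b) := con 0ℚ) refl
                                                                 (Cℚ (i ℕ.+ d) k) (Bplus ((i ℕ.+ d) ∸ k)) ⟩
      0ℚ                                                ∎
    term : ∀ l → l ≤ d → f (i ℕ.+ l) ≡ Cℚ (i ℕ.+ d) i * (Cℚ d l * Bplus (d ∸ l))
    term l l≤d = begin
      Cℚ (i ℕ.+ d) (i ℕ.+ l) * (Cℚ (i ℕ.+ l) i * Bplus ((i ℕ.+ d) ∸ (i ℕ.+ l)))
        ≡⟨ cong (λ z → Cℚ (i ℕ.+ d) (i ℕ.+ l) * (Cℚ (i ℕ.+ l) i * Bplus z)) (ℕₚ.[m+n]∸[m+o]≡n∸o i d l) ⟩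
      Cℚ (i ℕ.+ d) (i ℕ.+ l) * (Cℚ (i ℕ.+ l) i * Bplus (d ∸ l))
        ≡⟨ ℚₚ.*-assoc (Cℚ (i ℕ.+ d) (i ℕ.+ l)) (Cℚ (i ℕ.+ l) i) (Bplus (d ∸ l)) ⟨
      (Cℚ (i ℕ.+ d) (i ℕ.+ l) * Cℚ (i ℕ.+ l) i) * Bplus (d ∸ l)
        ≡⟨ cong (_* Bplus (d ∸ l)) subset-of-subset ⟩
      (Cℚ (i ℕ.+ d) i * Cℚ d l) * Bplus (d ∸ l)
        ≡⟨ ℚₚ.*-assoc (Cℚ (i ℕ.+ d) i) (Cℚ d l) (Bplus (d ∸ l)) ⟩
      Cℚ (i ℕ.+ d) i * (Cℚ d l * Bplus (d ∸ l))
        ∎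
      where
      subset-of-subset : Cℚ (i ℕ.+ d) (i ℕ.+ l) * Cℚ (i ℕ.+ l) i ≡ Cℚ (i ℕ.+ d) i * Cℚ d l
      subset-of-subset = trans (sym (ℕ→ℚ-* ((i ℕ.+ d) C (i ℕ.+ l)) ((i ℕ.+ l) C i)))
        (trans (cong ℕ→ℚ ([i+n]C[i+l]*[i+l]Ci≡[i+n]Ci*nCl i d l l≤d)) (ℕ→ℚ-* ((i ℕ.+ d) C i) (d C l)))

Σ<-Bplus-transform-binomial : ∀ n (a : ℕ → ℚ) →
  Σ< (suc n) (λ k → Cℚ n k * (Bplus (n ∸ k) * Σ< (suc k) (λ i → Cℚ k i * a i)))
  ≡ Σ< (suc n) (λ i → Cℚ n i * ((Bplus (n ∸ i) + ℕ→ℚ (n ∸ i)) * a i))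
Σ<-Bplus-transform-binomial n a = begin
  Σ< (suc n) (λ k → Cℚ n k * (Bplus (n ∸ k) * Σ< (suc k) (λ i → Cℚ k i * a i)))
    ≡⟨ Σ<-cong (suc n) (λ k k<1+n → cong (λ z → Cℚ n k * (Bplus (n ∸ k) * z))
                                         (sym (Σ<-extend k<1+n (λ i k<i _ → binomial-vanishes k<i)))) ⟩
  Σ< (suc n) (λ k → Cℚ n k * (Bplus (n ∸ k) * Σ< (suc n) (λ i → Cℚ k i * a i)))
    ≡⟨ Σ<-cong (suc n) (λ k _ → trans (cong (Cℚ n k *_) (*-distribˡ-Σ< (suc n) (Bplus (n ∸ k)) _))
                                      (*-distribˡ-Σ< (suc n) (Cℚ n k) _)) ⟩
  Σ< (suc n) (λ k → Σ< (suc n) (λ i → Cℚ n k * (Bplus (n ∸ k) * (Cℚ k i * a i))))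
    ≡⟨ Σ<-swap (suc n) (suc n) _ ⟩
  Σ< (suc n) (λ i → Σ< (suc n) (λ k → Cℚ n k * (Bplus (n ∸ k) * (Cℚ k i * a i))))
    ≡⟨ Σ<-cong (suc n) (λ i _ → trans (Σ<-cong (suc n) (λ k _ →
         solve 4 (λ c b c′ x → c :* (b :* (c′ :* x)) := x :* (c :* (c′ :* b))) refl
                 (Cℚ n k) (Bplus (n ∸ k)) (Cℚ k i) (a i)))
         (sym (*-distribˡ-Σ< (suc n) (a i) _))) ⟩
  Σ< (suc n) (λ i → a i * Σ< (suc n) (λ k → Cℚ n k * (Cℚ k i * Bplus (n ∸ k))))
    ≡⟨ Σ<-cong (suc n) (λ i i<1+n → cong (a i *_) (Σ<-C*C*Bplus (ℕₚ.≤-pred i<1+n))) ⟩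
  Σ< (suc n) (λ i → a i * (Cℚ n i * (Bplus (n ∸ i) + ℕ→ℚ (n ∸ i))))
    ≡⟨ Σ<-cong (suc n) (λ i _ → solve 3 (λ x c b → x :* (c :* b) := c :* (b :* x)) refl (a i) (Cℚ n i) _) ⟩
  Σ< (suc n) (λ i → Cℚ n i * ((Bplus (n ∸ i) + ℕ→ℚ (n ∸ i)) * a i))
    ∎
  where
  open ≡-Reasoning
  open ℚ-Solver.+-*-Solver
  binomial-vanishes : ∀ {k i} → k < i → Cℚ k i * a i ≡ 0ℚ
  binomial-vanishes {i = i} k<i = trans (cong (_* a i) (n<k⇒Cℚ[n,k]≡0 k<i)) (ℚₚ.*-zeroˡ (a i))

-- Adding X = Σ_k C(n,k) B⁺_{n-k} S(k,j) turns the left side into the B⁺-transform of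
-- S(k+1,j+1) = Σ_i C(k,i) S(i,j), after which X cancels.
Bplus-transform-Stirling-column : ∀ n j →
  ℕ→ℚ (suc j) * Σ< (suc n) (λ k → Cℚ n k * (Bplus (n ∸ k) * Sℚ k (suc j))) ≡ ℕ→ℚ n * Sℚ n (suc j)
Bplus-transform-Stirling-column n j = +-cancelʳ X _ _ (begin
  c * Σ< (suc n) (λ k → Cℚ n k * (Bplus (n ∸ k) * Sℚ k (suc j))) + X
    ≡⟨ cong (_+ X) (*-distribˡ-Σ< (suc n) c _) ⟩
  Σ< (suc n) (λ k → c * (Cℚ n k * (Bplus (n ∸ k) * Sℚ k (suc j)))) + X
    ≡⟨ Σ<-distrib-+ (suc n) _ _ ⟨
  Σ< (suc n) (λ k → c * (Cℚ n k * (Bplus (n ∸ k) * Sℚ k (suc j))) + Cℚ n k * (Bplus (n ∸ k) * Sℚ k j))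
    ≡⟨ Σ<-cong (suc n) (λ k _ → trans (solve 5 (λ c C b s s′ → c :* (C :* (b :* s)) :+ C :* (b :* s′)
                                                            := C :* (b :* (c :* s :+ s′)))
                                              refl c (Cℚ n k) (Bplus (n ∸ k)) (Sℚ k (suc j)) (Sℚ k j))
                                     (cong (λ z → Cℚ n k * (Bplus (n ∸ k) * z))
                                           (trans (sym (Sℚ-suc-suc k j)) (Sℚ-binomial k j)))) ⟩
  Σ< (suc n) (λ k → Cℚ n k * (Bplus (n ∸ k) * Σ< (suc k) (λ i → Cℚ k i * Sℚ i j)))
    ≡⟨ Σ<-Bplus-transform-binomial n (λ i → Sℚ i j) ⟩
  Σ< (suc n) (λ i → Cℚ n i * ((Bplus (n ∸ i) + ℕ→ℚ (n ∸ i)) * Sℚ i j))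
    ≡⟨ Σ<-cong (suc n) (λ i _ → solve 4 (λ C b d s → C :* ((b :+ d) :* s) := C :* (d :* s) :+ C :* (b :* s))
                                        refl (Cℚ n i) (Bplus (n ∸ i)) (ℕ→ℚ (n ∸ i)) (Sℚ i j)) ⟩
  Σ< (suc n) (λ i → Cℚ n i * (ℕ→ℚ (n ∸ i) * Sℚ i j) + Cℚ n i * (Bplus (n ∸ i) * Sℚ i j))
    ≡⟨ Σ<-distrib-+ (suc n) _ _ ⟩
  Σ< (suc n) (λ i → Cℚ n i * (ℕ→ℚ (n ∸ i) * Sℚ i j)) + X
    ≡⟨ cong (_+ X) (Σ<-C*[n∸i]*S n) ⟩
  ℕ→ℚ n * Sℚ n (suc j) + X
    ∎)
  where
  open ≡-Reasoning
  open ℚ-Solver.+-*-Solver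
  c = ℕ→ℚ (suc j)
  X = Σ< (suc n) (λ k → Cℚ n k * (Bplus (n ∸ k) * Sℚ k j))
  Σ<-C*[n∸i]*S : ∀ n → Σ< (suc n) (λ i → Cℚ n i * (ℕ→ℚ (n ∸ i) * Sℚ i j)) ≡ ℕ→ℚ n * Sℚ n (suc j)
  Σ<-C*[n∸i]*S zero    = solve 1 (λ s → con 0ℚ :+ con 1ℚ :* (con 0ℚ :* s) := con 0ℚ :* con 0ℚ)
                                 refl (Sℚ 0 j)
  Σ<-C*[n∸i]*S (suc m) = trans (Σ<-C*[n∸i] m (λ i → Sℚ i j))
                               (cong (ℕ→ℚ (suc m) *_) (sym (Sℚ-binomial m j)))

stirling : ℕ → (ℕ → ℚ) → ℚ
stirling n c = sum1 n (λ j → Sℚ n j * c j)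

φ≡stirling-pow : ∀ m x → φ (suc m) x ≡ stirling (suc m) (pow x)
φ≡stirling-pow m x = begin
  sum0 (suc m) (λ k → Sℚ (suc m) k * pow x k)                      ≡⟨ sum0≡Σ< (suc m) _ ⟩
  Σ< (suc (suc m)) (λ k → Sℚ (suc m) k * pow x k)                  ≡⟨ Σ<-suc (suc m) _ ⟩
  0ℚ + Σ< (suc m) (λ k → Sℚ (suc m) (suc k) * pow x (suc k))       ≡⟨ ℚₚ.+-identityˡ _ ⟩
  Σ< (suc m) (λ k → Sℚ (suc m) (suc k) * pow x (suc k))            ≡⟨ sum1≡Σ< (suc m) _ ⟨
  stirling (suc m) (pow x)                                         ∎
  where open ≡-Reasoning

Bplus-transform-stirling : ∀ n (c : ℕ → ℚ) →
  Σ< (suc n) (λ k → Cℚ n k * Bplus (n ∸ k) * stirling k c) ≡ ℕ→ℚ n * stirling n (λ j → c j * inv j)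
Bplus-transform-stirling n c = begin
  Σ< (suc n) (λ k → Cℚ n k * Bplus (n ∸ k) * stirling k c)
    ≡⟨ Σ<-cong (suc n) (λ k k<1+n → cong (Cℚ n k * Bplus (n ∸ k) *_)
                          (trans (sum1≡Σ< k _)
                                 (sym (Σ<-extend (ℕₚ.≤-pred k<1+n) (λ j k≤j _ → column-vanishes k≤j))))) ⟩
  Σ< (suc n) (λ k → Cℚ n k * Bplus (n ∸ k) * Σ< n (λ j → Sℚ k (suc j) * c (suc j)))
    ≡⟨ Σ<-cong (suc n) (λ k _ → *-distribˡ-Σ< n (Cℚ n k * Bplus (n ∸ k)) _) ⟩
  Σ< (suc n) (λ k → Σ< n (λ j → Cℚ n k * Bplus (n ∸ k) * (Sℚ k (suc j) * c (suc j))))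
    ≡⟨ Σ<-swap (suc n) n _ ⟩
  Σ< n (λ j → Σ< (suc n) (λ k → Cℚ n k * Bplus (n ∸ k) * (Sℚ k (suc j) * c (suc j))))
    ≡⟨ Σ<-cong n (λ j _ → trans (Σ<-cong (suc n) (λ k _ →
          solve 4 (λ C b s x → C :* b :* (s :* x) := x :* (C :* (b :* s))) refl
                  (Cℚ n k) (Bplus (n ∸ k)) (Sℚ k (suc j)) (c (suc j))))
          (sym (*-distribˡ-Σ< (suc n) (c (suc j)) _))) ⟩
  Σ< n (λ j → c (suc j) * Σ< (suc n) (λ k → Cℚ n k * (Bplus (n ∸ k) * Sℚ k (suc j))))
    ≡⟨ Σ<-cong n (λ j _ → cong (c (suc j) *_) (column j)) ⟩
  Σ< n (λ j → c (suc j) * (inv (suc j) * (ℕ→ℚ n * Sℚ n (suc j))))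
    ≡⟨ Σ<-cong n (λ j _ → solve 4 (λ x i N s → x :* (i :* (N :* s)) := N :* (s :* (x :* i))) refl
                                  (c (suc j)) (inv (suc j)) (ℕ→ℚ n) (Sℚ n (suc j))) ⟩
  Σ< n (λ j → ℕ→ℚ n * (Sℚ n (suc j) * (c (suc j) * inv (suc j))))
    ≡⟨ *-distribˡ-Σ< n (ℕ→ℚ n) _ ⟨
  ℕ→ℚ n * Σ< n (λ j → Sℚ n (suc j) * (c (suc j) * inv (suc j)))
    ≡⟨ cong (ℕ→ℚ n *_) (sum1≡Σ< n _) ⟨
  ℕ→ℚ n * stirling n (λ j → c j * inv j)
    ∎
  where
  open ≡-Reasoning
  open ℚ-Solver.+-*-Solver
  column-vanishes : ∀ {k j} → k ≤ j → Sℚ k (suc j) * c (suc j) ≡ 0ℚ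
  column-vanishes {k} {j} k≤j =
    trans (cong (_* c (suc j)) (k<j⇒Sℚ[k,j]≡0 (s≤s k≤j))) (ℚₚ.*-zeroˡ (c (suc j)))
  column : ∀ j → Σ< (suc n) (λ k → Cℚ n k * (Bplus (n ∸ k) * Sℚ k (suc j)))
                 ≡ inv (suc j) * (ℕ→ℚ n * Sℚ n (suc j))
  column j = trans (sym (inv-cancelˡ j _)) (cong (inv (suc j) *_) (Bplus-transform-Stirling-column n j))

inv-*-Bplus-transform-stirling : ∀ n (c : ℕ → ℚ) →
  inv (suc n) * sum1 (suc n) (λ k → Cℚ (suc n) k * Bplus (suc n ∸ k) * stirling k c)
  ≡ stirling (suc n) (λ j → c j * inv j)
inv-*-Bplus-transform-stirling n c = begin
  inv (suc n) * sum1 (suc n) (λ k → Cℚ (suc n) k * Bplus (suc n ∸ k) * stirling k c)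
    ≡⟨ cong (inv (suc n) *_) (sum1≡Σ<-from-0 (suc n) _ (ℚₚ.*-zeroʳ (Cℚ (suc n) 0 * Bplus (suc n)))) ⟩
  inv (suc n) * Σ< (suc (suc n)) (λ k → Cℚ (suc n) k * Bplus (suc n ∸ k) * stirling k c)
    ≡⟨ cong (inv (suc n) *_) (Bplus-transform-stirling (suc n) c) ⟩
  inv (suc n) * (ℕ→ℚ (suc n) * stirling (suc n) (λ j → c j * inv j))
    ≡⟨ inv-cancelˡ n _ ⟩
  stirling (suc n) (λ j → c j * inv j)
    ∎
  where open ≡-Reasoning

inv-*-Bplus-transform-φ : ∀ k x →
  inv (suc k) * sum1 (suc k) (λ m → Cℚ (suc k) m * Bplus (suc k ∸ m) * φ m x)
  ≡ stirling (suc k) (λ j → pow x j * inv j)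
inv-*-Bplus-transform-φ k x = trans
  (cong (inv (suc k) *_) (sum1-cong (suc k) (λ m →
     cong (Cℚ (suc k) (suc m) * Bplus (suc k ∸ suc m) *_) (φ≡stirling-pow m x))))
  (inv-*-Bplus-transform-stirling k (pow x))

Σ-S[n,k]x^k/k²-formula : ∀ n x →
  sum1 (suc n) (λ k → Sℚ (suc n) k * (pow x k * (inv k * inv k)))
  ≡ inv (suc n) * sum1 (suc n) (λ k → Cℚ (suc n) k * Bplus (suc n ∸ k)
      * (inv k * sum1 k (λ m → Cℚ k m * Bplus (k ∸ m) * φ m x)))
Σ-S[n,k]x^k/k²-formula n x = begin
  sum1 (suc n) (λ k → Sℚ (suc n) k * (pow x k * (inv k * inv k)))
    ≡⟨ sum1-cong (suc n) (λ k → cong (Sℚ (suc n) (suc k) *_) (sym (ℚₚ.*-assoc (pow x (suc k)) _ _))) ⟩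
  stirling (suc n) (λ j → pow x j * inv j * inv j)
    ≡⟨ inv-*-Bplus-transform-stirling n (λ j → pow x j * inv j) ⟨
  inv (suc n) * sum1 (suc n) (λ k → Cℚ (suc n) k * Bplus (suc n ∸ k) * stirling k (λ j → pow x j * inv j))
    ≡⟨ cong (inv (suc n) *_) (sum1-cong (suc n) (λ k → cong (Cℚ (suc n) (suc k) * Bplus (suc n ∸ suc k) *_)
                                                            (inv-*-Bplus-transform-φ k x))) ⟨
  inv (suc n) * sum1 (suc n) (λ k → Cℚ (suc n) k * Bplus (suc n ∸ k)
      * (inv k * sum1 k (λ m → Cℚ k m * Bplus (k ∸ m) * φ m x)))
    ∎
  where open ≡-Reasoning

mainTheorem10 : (n : ℕ) → 2 ≤ n →
    ((x : ℚ) →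
      sum1 n (λ k → ℕ→ℚ (S n k) * (pow x k * (inv k * inv k)))
      ≡ inv n * sum1 n (λ k → ℕ→ℚ (n C k) * Bplus (n ∸ k)
          * (inv k * sum1 k (λ m → ℕ→ℚ (k C m) * Bplus (k ∸ m) * φ m x))))
    × (sum1 n (λ k → ℕ→ℚ (S n k) * (inv k * inv k))
      ≡ inv n * sum1 n (λ k → ℕ→ℚ (n C k) * Bplus (n ∸ k)
          * (inv k * sum1 k (λ m → ℕ→ℚ (k C m) * Bplus (k ∸ m) * bell m))))
mainTheorem10 (suc n) _ =
  Σ-S[n,k]x^k/k²-formula n ,
  trans (sum1-cong (suc n) (λ k → cong (Sℚ (suc n) (suc k) *_) (sym (at-1ℚ k))))
        (Σ-S[n,k]x^k/k²-formula n 1ℚ)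
  where
  at-1ℚ : ∀ k → pow 1ℚ (suc k) * (inv (suc k) * inv (suc k)) ≡ inv (suc k) * inv (suc k)
  at-1ℚ k = trans (cong (_* (inv (suc k) * inv (suc k))) (pow-1ℚ (suc k))) (ℚₚ.*-identityˡ _)
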